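{- Let $\mathfrak{X}=(X,\preceq,\sqsubset)$ be a $\rightsquigarrow$-frame. (1) $\mathfrak X$ validates all instances of $(\varphi\to\psi)\to(\varphi\rightsquigarrow\psi)$ iff for all $x,y\in X$, $x\sqsubset y$ implies $x\preceq y$. (2) $\mathfrak X$ validates all instances of $(\varphi\rightsquigarrow\psi)\to\neg\neg(\varphi\to\psi)$ iff for every $x\in X$ there is $y\in X$ with $x\preceq y$ and $x\sqsubset y$.
   Context: Formulas: $\varphi::=p\mid\top\mid\bot\mid\varphi\wedge\varphi\mid\varphi\vee\varphi\mid\varphi\to\varphi\mid\varphi\rightsquigarrow\varphi$; $\neg\varphi:=\varphi\to\bot$. A $\rightsquigarrow$-frame is $(X,\preceq,\sqsubset)$ with $\preceq$ a partial order on $X$ and $\sqsubset$ a binary relation on $X$ such that $x\preceq y\sqsubset z$ implies $x\sqsubset z$. A valuation assigns to each propositional variable an upset of $(X,\preceq)$; truth is defined by: $x\Vdash\top$ always, never $x\Vdash\bot$, $\wedge,\vee$ pointwise, $x\Vdash\varphi\to\psi$ iff for all $y$ with $x\preceq y$ and $y\Vdash\varphi$ we have $y\Vdash\psi$, and $x\Vdash\varphi\rightsquigarrow\psi$ iff for all $y$ with $x\sqsubset y$ and $y\Vdash\varphi$ we have $y\Vdash\psi$. The frame validates $\varphi$ if $\varphi$ is true at every point under every valuation. -}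

module Defs where

open import Data.Nat using (ℕ)
open import Data.Unit using (⊤)
open import Data.Empty using (⊥)
open import Data.Product using (_×_; Σ)
open import Data.Sum using (_⊎_)
open import Relation.Binary.PropositionalEquality using (_≡_)
open import Relation.Binary.Structures using (IsPartialOrder)

data Form : Set where
  var  : ℕ → Form
  ⊤'   : Form
  ⊥'   : Form
  _∧'_ : Form → Form → Form
  _∨'_ : Form → Form → Form
  _⇒_  : Form → Form → Form
  _↝_  : Form → Form → Form

infixr 5 _⇒_ _↝_
infixr 6 _∨'_
infixr 7 _∧'_

¬' : Form → Form
¬' φ = φ ⇒ ⊥'

record Frame : Set₁ where
  field
    X       : Set
    _≼_     : X → X → Set
    _⊏_     : X → X → Set
    ≼-po    : IsPartialOrder _≡_ _≼_
    ≼⊏⇒⊏    : ∀ {x y z} → x ≼ y → y ⊏ z → x ⊏ z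

record Valuation (F : Frame) : Set₁ where
  open Frame F
  field
    V     : ℕ → X → Set
    upset : ∀ p {x y} → x ≼ y → V p x → V p y

module _ (F : Frame) where
  open Frame F

  _,_⊩_ : Valuation F → X → Form → Set
  M , x ⊩ var p  = Valuation.V M p x
  M , x ⊩ ⊤'     = ⊤
  M , x ⊩ ⊥'     = ⊥
  M , x ⊩ (φ ∧' ψ) = (M , x ⊩ φ) × (M , x ⊩ ψ)
  M , x ⊩ (φ ∨' ψ) = (M , x ⊩ φ) ⊎ (M , x ⊩ ψ)
  M , x ⊩ (φ ⇒ ψ)  = ∀ y → x ≼ y → M , y ⊩ φ → M , y ⊩ ψ
  M , x ⊩ (φ ↝ ψ)  = ∀ y → x ⊏ y → M , y ⊩ φ → M , y ⊩ ψ

  Valid : Form → Set₁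
  Valid φ = (M : Valuation F) (x : X) → M , x ⊩ φ

-- Both frame conditions are read off the principal valuation p ↦ ↑x: with it,
-- (⊤ → p) → (⊤ ⇝ p) says every ⊏-successor of x lies above x, and (p ⇝ ⊥) → ¬¬(p → ⊥)
-- at x fails when no y has x ≼ y and x ⊏ y, which yields such a y only up to
-- double negation (hence excluded middle). Conversely, ⊏ ⊆ ≼ lets an
-- implication be used along ⊏, and a ≼∩⊏-successor of any point forcing φ turns
-- φ ⇝ ψ into a witness of ψ there, refuting ¬(φ → ψ).
module Submission where

open import Defs hiding (_,_⊩_)
open import Defs using () renaming (_,_⊩_ to forces)
open import Data.Product using (_×_; Σ-syntax; _,_)
open import Function.Bundles using (_⇔_; mk⇔)
open import Data.Sum using (_⊎_; inj₁; inj₂)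
open import Data.Unit using (tt)
open import Data.Empty using (⊥; ⊥-elim)
open import Relation.Nullary using (¬_)
open import Relation.Binary.Structures using (IsPartialOrder)

module _ (F : Frame) where
  open Frame F
  open IsPartialOrder ≼-po using () renaming (refl to ≼-refl; trans to ≼-trans)

  _,_⊩_ : Valuation F → X → Form → Set
  M , x ⊩ φ = forces F M x φ

  ⊩-upward-closed : ∀ (M : Valuation F) φ {x y} → x ≼ y → M , x ⊩ φ → M , y ⊩ φ
  ⊩-upward-closed M (var p)  x≼y x⊩p             = Valuation.upset M p x≼y x⊩p
  ⊩-upward-closed M ⊤'       x≼y _               = tt
  ⊩-upward-closed M (φ ∧' ψ) x≼y (x⊩φ , x⊩ψ)     = ⊩-upward-closed M φ x≼y x⊩φ , ⊩-upward-closed M ψ x≼y x⊩ψ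
  ⊩-upward-closed M (φ ∨' ψ) x≼y (inj₁ x⊩φ)      = inj₁ (⊩-upward-closed M φ x≼y x⊩φ)
  ⊩-upward-closed M (φ ∨' ψ) x≼y (inj₂ x⊩ψ)      = inj₂ (⊩-upward-closed M ψ x≼y x⊩ψ)
  ⊩-upward-closed M (φ ⇒ ψ)  x≼y x⊩φ⇒ψ z y≼z     = x⊩φ⇒ψ z (≼-trans x≼y y≼z)
  ⊩-upward-closed M (φ ↝ ψ)  x≼y x⊩φ↝ψ z y⊏z     = x⊩φ↝ψ z (≼⊏⇒⊏ x≼y y⊏z)

  principal : X → Valuation F
  principal x = record { V = λ _ y → x ≼ y ; upset = λ _ y≼z x≼y → ≼-trans x≼y y≼z }

  ⊩-⇒-of-⊩-consequent : ∀ (M : Valuation F) φ ψ {x} → M , x ⊩ ψ → M , x ⊩ (φ ⇒ ψ)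
  ⊩-⇒-of-⊩-consequent M φ ψ x⊩ψ y x≼y _ = ⊩-upward-closed M ψ x≼y x⊩ψ

  valid-⇒⇝-of-⊏⊆≼ : (∀ x y → x ⊏ y → x ≼ y) → ∀ φ ψ → Valid F ((φ ⇒ ψ) ⇒ (φ ↝ ψ))
  valid-⇒⇝-of-⊏⊆≼ ⊏⊆≼ φ ψ M x y x≼y y⊩φ⇒ψ z y⊏z = y⊩φ⇒ψ z (⊏⊆≼ y z y⊏z)

  ⊏⊆≼-of-valid-⇒⇝ : (∀ φ ψ → Valid F ((φ ⇒ ψ) ⇒ (φ ↝ ψ))) → ∀ x y → x ⊏ y → x ≼ y
  ⊏⊆≼-of-valid-⇒⇝ valid x y x⊏y =
    valid ⊤' (var 0) (principal x) x x ≼-refl (λ z x≼z _ → x≼z) y x⊏y tt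

  valid-⇝¬¬⇒-of-serial : (∀ x → Σ[ y ∈ X ] (x ≼ y × x ⊏ y))
                       → ∀ φ ψ → Valid F ((φ ↝ ψ) ⇒ ¬' (¬' (φ ⇒ ψ)))
  valid-⇝¬¬⇒-of-serial serial φ ψ M x y x≼y y⊩φ↝ψ z y≼z z⊩¬[φ⇒ψ] =
    z⊩¬[φ⇒ψ] z ≼-refl (λ u z≼u u⊩φ → ⊥-elim (refute u z≼u u⊩φ))
    where
    refute : ∀ u → z ≼ u → M , u ⊩ φ → ⊥
    refute u z≼u u⊩φ with serial u
    ... | s , u≼s , u⊏s =
      z⊩¬[φ⇒ψ] s (≼-trans z≼u u≼s) (⊩-⇒-of-⊩-consequent M φ ψ s⊩ψ)
      where
      s⊩ψ : M , s ⊩ ψ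
      s⊩ψ = y⊩φ↝ψ s (≼⊏⇒⊏ (≼-trans y≼z z≼u) u⊏s) (⊩-upward-closed M φ u≼s u⊩φ)

  ¬¬serial-of-valid-⇝¬¬⇒ : (∀ φ ψ → Valid F ((φ ↝ ψ) ⇒ ¬' (¬' (φ ⇒ ψ))))
                         → ∀ x → ¬ ¬ (Σ[ y ∈ X ] (x ≼ y × x ⊏ y))
  ¬¬serial-of-valid-⇝¬¬⇒ valid x no-successor =
    valid (var 0) ⊥' (principal x) x x ≼-refl x⊩p↝⊥ x ≼-refl x⊩¬[p⇒⊥]
    where
    x⊩p↝⊥ : principal x , x ⊩ (var 0 ↝ ⊥')
    x⊩p↝⊥ y x⊏y x≼y = no-successor (y , x≼y , x⊏y)

    x⊩¬[p⇒⊥] : principal x , x ⊩ ¬' (var 0 ⇒ ⊥')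
    x⊩¬[p⇒⊥] y x≼y y⊩p⇒⊥ = y⊩p⇒⊥ y ≼-refl x≼y

¬¬-elim : ((P : Set) → P ⊎ ¬ P) → {P : Set} → ¬ ¬ P → P
¬¬-elim lem {P} ¬¬p with lem P
... | inj₁ p  = p
... | inj₂ ¬p = ⊥-elim (¬¬p ¬p)

proposition3p9 : (lem : (P : Set) → P ⊎ ¬ P) → (F : Frame) → let open Frame F in
    ((∀ φ ψ → Valid F ((φ ⇒ ψ) ⇒ (φ ↝ ψ))) ⇔ (∀ x y → x ⊏ y → x ≼ y))
    × ((∀ φ ψ → Valid F ((φ ↝ ψ) ⇒ ¬' (¬' (φ ⇒ ψ)))) ⇔ (∀ x → Σ[ y ∈ X ] (x ≼ y × x ⊏ y)))
proposition3p9 lem F =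
    mk⇔ (⊏⊆≼-of-valid-⇒⇝ F) (valid-⇒⇝-of-⊏⊆≼ F)
  , mk⇔ (λ valid x → ¬¬-elim lem (¬¬serial-of-valid-⇝¬¬⇒ F valid x)) (valid-⇝¬¬⇒-of-serial F)
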